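{- For the single-machine algorithm $\mathcal{A}$ described in the context, $\sum_j\alpha_j^+\le O(1/\epsilon)\cdot\big(\sum_j w_jp_j+\sum_{j\in J^{imm}}\alpha_j^+\big)$, where unrestricted sums range over all released jobs and the constant in $O(\cdot)$ is absolute.
   Context: Single machine; a finite set of jobs arrives online; job $j$ has integer release time $r_j$, integer processing time $p_j>0$ and weight $w_j>0$; its density is $\rho_j=w_j/p_j$. The parameter $\epsilon$ satisfies $\epsilon^2\le 1/2$ and $1/\epsilon\in\mathbb{Z}$. For $x>0$, $\lfloor x\rfloor_2$ denotes the largest integer $i$ with $2^i\le x$; $\lfloor\rho_j\rfloor_2$ is the density class of $j$. Algorithm $\mathcal{A}$ (which may reject and preempt) works in unit time slots. A job is active at time $t$ if it has been released by $t$, has not finished by $t$ and has not been rejected; $A(t)$ is the active set. $p_j(t)$ is the remaining processing time of $j$ at time $t$ and $w_j(t)=\rho_j p_j(t)$. A set $L$ of "preemptible" jobs is maintained; once a job enters $L$ it stays there until it finishes. At each integer time $t$: (1) each job arriving at $t$ (jobs arriving simultaneously are considered one at a time in a fixed arbitrary order, steps (1)-(2) being done for each) is either immediately rejected by the rule below or added to the active set; (2) if the job $j$ processed in slot $[t-1,t]$ is not in $L$, let $t'$ be the time $\mathcal{A}$ started processing $j$ (so $j$ was processed uninterruptedly during $[t',t]$); if the total weight of jobs arriving during $(t',t]$ exceeds $w_j/\epsilon$, then $j$ is added to $L$; (3) if the job processed in $[t-1,t]$ has not finished and is not in $L$, it is processed in $[t,t+1]$; otherwise $\mathcal{A}$ processes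 in $[t,t+1]$ an active job of highest density. For an arriving job $j$, $A(r_j)$ denotes the jobs active at time $r_j$, excluding $j$ and excluding jobs arriving at $r_j$ that are considered after $j$. Let $D_j^+=\{j'\in A(r_j):\lfloor\rho_{j'}\rfloor_2\ge\lfloor\rho_j\rfloor_2\}$, $D_j^-=A(r_j)\setminus D_j^+$, $\alpha_j^+=w_j\sum_{j'\in D_j^+,\rho_{j'}\ge\rho_j}p_{j'}(r_j)+p_j\sum_{j'\in D_j^+,\rho_{j'}<\rho_j}w_{j'}(r_j)$, $\alpha_j^-=p_j\sum_{j'\in D_j^- }w_{j'}(r_j)$. Immediate rejection rule. Table $T^+$: if $\alpha_j^+\ge w_jp_j/\epsilon$, $j$ is assigned to the bucket $(\lfloor\alpha_j^+/w_j\rfloor_2,\lfloor w_j\rfloor_2)$ of $T^+$; in each bucket of $T^+$, the first job assigned to it is rejected, and then every $(1/\epsilon)$-th subsequent job. Table $T^-$: if $\alpha_j^->w_jp_j/\epsilon$, $j$ is assigned to the bucket $(\lfloor\alpha_j^-\rfloor_2,\lfloor\rho_j\rfloor_2,\lfloor p_j\rfloor_2)$ of $T^-$; in each bucket of $T^-$, every $(1/\epsilon)$-th job assigned to it is rejected (the first rejected one being the $(1/\epsilon)$-th). $J^{imm}$ is the set of jobs rejected upon arrival by this rule.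
   Formalization: The job weights $w_j$ take values in the positive rationals. -}

module Defs where

open import Data.Bool using (Bool; true; false; if_then_else_; _∧_; _∨_; not)
open import Data.Nat as ℕ using (ℕ; zero; suc; _∸_; _^_; NonZero)
open import Data.Nat.Divisibility using (_∣?_)
open import Data.Integer as ℤ using (ℤ; +_; -[1+_])
open import Data.Rational as ℚ using (ℚ; 0ℚ; 1ℚ; _/_; ↥_; ↧ₙ_)
open import Data.Fin using (Fin; toℕ; _≟_)
open import Data.List using (List; []; _∷_; foldr; foldl; map; upTo; allFin; filter; length; _++_)
open import Data.Maybe using (Maybe; just; nothing)
open import Data.Product using (_×_; _,_; Σ)
open import Relation.Nullary.Decidable using (⌊_⌋)
open import Relation.Binary.PropositionalEquality using (_≡_)
open import Relation.Nullary using (¬_)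

ofℕ : ℕ → ℚ
ofℕ m = + m / 1

Σℚ : (n : ℕ) → (Fin n → ℚ) → ℚ
Σℚ n f = foldr (λ i acc → f i ℚ.+ acc) 0ℚ (allFin n)

Σℚ[_] : {n : ℕ} → (Fin n → Bool) → (Fin n → ℚ) → ℚ
Σℚ[_] {n} P f = Σℚ n (λ i → if P i then f i else 0ℚ)

-- 2^i ≤ A / B  (for an integer i and naturals A, B > 0)
pow2Le : ℤ → ℕ → ℕ → Bool
pow2Le (+ m)     A B = (2 ^ m) ℕ.* B ℕ.≤ᵇ A
pow2Le -[1+ m ]  A B = B ℕ.≤ᵇ (2 ^ suc m) ℕ.* A

-- ⌊A/B⌋₂ = the largest integer i with 2^i ≤ A/B  (A, B > 0).
-- That integer lies in [-B, A]  (2^(-B) ≤ 1/B ≤ A/B and A/B ≤ A < 2^(A+1)),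
-- and {i | 2^i ≤ A/B} is downward closed, so scanning the candidates
-- -B, -B+1, ..., A in increasing order and keeping the last one that
-- satisfies 2^i ≤ A/B yields exactly that largest integer.
lg2ℕ : ℕ → ℕ → ℤ
lg2ℕ A B = foldl (λ acc i → if pow2Le i A B then i else acc) (ℤ.- (+ B))
                 (map (λ m → (+ m) ℤ.- (+ B)) (upTo (suc (B ℕ.+ A))))

lg2 : ℚ → ℚ → ℤ
lg2 a b = lg2ℕ (ℤ.∣ ↥ a ∣ ℕ.* ↧ₙ b) (↧ₙ a ℕ.* ℤ.∣ ↥ b ∣)

⌊_⌋₂ : ℚ → ℤ
⌊ x ⌋₂ = lg2 x 1ℚ

count : {A : Set} → ((x y : A) → Bool) → A → List A → ℕ
count eq x = foldr (λ y c → if eq x y then suc c else c) 0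

eqℤ : ℤ → ℤ → Bool
eqℤ a b = ⌊ a ℤ.≟ b ⌋

KeyP : Set
KeyP = ℤ × ℤ

KeyM : Set
KeyM = ℤ × ℤ × ℤ

eqP : KeyP → KeyP → Bool
eqP (a , b) (c , d) = eqℤ a c ∧ eqℤ b d

eqM : KeyM → KeyM → Bool
eqM (a , b , c) (d , e , f) = eqℤ a d ∧ eqℤ b e ∧ eqℤ c f

-- State of algorithm A at an integer time t (before the decisions at t)

record St (n : ℕ) : Set where
  field
    rem   : Fin n → ℕ
    rej   : Fin n → Bool
    inL   : Fin n → Bool       -- member of the set L of preemptible jobs
    cur   : Maybe (Fin n)      -- job processed in slot [t-1,t] (nothing = idle)
    start : ℕ                  -- time t' at which cur started its uninterrupted run
    histP : List KeyP          -- buckets of T+ assigned so far (with multiplicity)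
    histM : List KeyM          -- buckets of T- assigned so far (with multiplicity)
    aP    : Fin n → ℚ          -- α⁺_j, recorded when j arrives
open St public

-- The algorithm, for ε = 1/k, jobs Fin n (index order = the fixed
-- order in which simultaneously arriving jobs are considered),
-- release times r, processing times p (> 0), weights w (> 0).

module Alg (k n : ℕ) (r p : Fin n → ℕ) (w : Fin n → ℚ)
           (pNZ : (j : Fin n) → NonZero (p j)) where

  ρ : Fin n → ℚ
  ρ j = w j ℚ.* ((+ 1 / p j) {{pNZ j}})

  cls : Fin n → ℤ
  cls j = ⌊ ρ j ⌋₂

  init : St n
  init = record { rem = p ; rej = λ _ → false ; inL = λ _ → false
                ; cur = nothing ; start = 0 ; histP = [] ; histM = []
                ; aP = λ _ → 0ℚ }

  wrem : St n → Fin n → ℚ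
  wrem s j = ρ j ℚ.* ofℕ (rem s j)

  -- j' ∈ A(r_j) when j arrives at time t = r_j: released before t, or
  -- released at t and considered before j; not finished; not rejected.
  actArr : St n → ℕ → Fin n → Fin n → Bool
  actArr s t j j' =
    ((r j' ℕ.<ᵇ t) ∨ ((r j' ℕ.≡ᵇ t) ∧ (toℕ j' ℕ.<ᵇ toℕ j)))
    ∧ not (rej s j') ∧ (0 ℕ.<ᵇ rem s j')

  inDp : Fin n → Fin n → Bool
  inDp j j' = cls j ℤ.≤ᵇ cls j'

  alphaP : St n → ℕ → Fin n → ℚ
  alphaP s t j =
    w j ℚ.* Σℚ[ (λ j' → actArr s t j j' ∧ inDp j j' ∧ (ρ j ℚ.≤ᵇ ρ j')) ] (λ j' → ofℕ (rem s j'))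
    ℚ.+ ofℕ (p j) ℚ.* Σℚ[ (λ j' → actArr s t j j' ∧ inDp j j' ∧ not (ρ j ℚ.≤ᵇ ρ j')) ] (wrem s)

  alphaM : St n → ℕ → Fin n → ℚ
  alphaM s t j = ofℕ (p j) ℚ.* Σℚ[ (λ j' → actArr s t j j' ∧ not (inDp j j')) ] (wrem s)

  thr : Fin n → ℚ
  thr j = ofℕ k ℚ.* w j ℚ.* ofℕ (p j)

  arrive : ℕ → Fin n → St n → St n
  arrive t j s =
    let αp = alphaP s t j
        αm = alphaM s t j
        inTp = thr j ℚ.≤ᵇ αp
        inTm = not (αm ℚ.≤ᵇ thr j)
        kp : KeyP
        kp = (lg2 αp (w j) , ⌊ w j ⌋₂)
        km : KeyM
        km = (⌊ αm ⌋₂ , cls j , ⌊ ofℕ (p j) ⌋₂)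
        -- T+: first job of the bucket rejected, then every k-th subsequent
        rejP = inTp ∧ ⌊ k ∣? count eqP kp (histP s) ⌋
        -- T-: the k-th, 2k-th, ... job of the bucket rejected
        rejM = inTm ∧ ⌊ k ∣? suc (count eqM km (histM s)) ⌋
    in record s
      { rej   = λ i → if ⌊ i ≟ j ⌋ then rejP ∨ rejM else rej s i
      ; histP = if inTp then histP s ++ (kp ∷ []) else histP s
      ; histM = if inTm then histM s ++ (km ∷ []) else histM s
      ; aP    = λ i → if ⌊ i ≟ j ⌋ then αp else aP s i
      }

  arrivals : ℕ → St n → St n
  arrivals t s = foldl (λ s' j → arrive t j s') s
                       (filter (λ j → r j ℕ.≟ t) (allFin n))

  updL : ℕ → St n → St n
  updL t s with cur s
  ... | nothing = s
  ... | just j  =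
    if not (inL s j)
       ∧ not (Σℚ[ (λ i → (start s ℕ.<ᵇ r i) ∧ (r i ℕ.≤ᵇ t)) ] w ℚ.≤ᵇ ofℕ k ℚ.* w j)
    then record s { inL = λ i → if ⌊ i ≟ j ⌋ then true else inL s i }
    else s

  mid : ℕ → St n → St n
  mid t s = updL t (arrivals t s)

  contJob : St n → Maybe (Fin n)
  contJob s with cur s
  ... | nothing = nothing
  ... | just j  = if (0 ℕ.<ᵇ rem s j) ∧ not (inL s j) then just j else nothing

  Active : St n → ℕ → Fin n → Set
  Active s t i = (r i ℕ.≤ (t)) × (rej s i ≡ false) × (0 ℕ.< rem s i)

  run : Fin n → St n → St n
  run j s = record s { rem = λ i → if ⌊ i ≟ j ⌋ then rem s i ∸ 1 else rem s i
                     ; cur = just j }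

  -- one time step t → t+1 (step (3) may choose among several jobs of
  -- highest density, hence a relation)
  data Step (t : ℕ) (s s' : St n) : Set where
    continue : (j : Fin n) → contJob (mid t s) ≡ just j
             → s' ≡ run j (mid t s) → Step t s s'
    pick     : contJob (mid t s) ≡ nothing → (i : Fin n) → Active (mid t s) t i
             → ((i' : Fin n) → Active (mid t s) t i' → ρ i' ℚ.≤ ρ i)
             → s' ≡ record (run i (mid t s)) { start = t } → Step t s s'
    idle     : contJob (mid t s) ≡ nothing
             → ((i : Fin n) → ¬ Active (mid t s) t i)
             → s' ≡ record (mid t s) { cur = nothing ; start = t } → Step t s s'

  IsRun : (ℕ → St n) → Set
  IsRun tr = (tr 0 ≡ init) × ((t : ℕ) → Step t (tr t) (tr (suc t)))

  αplus : (ℕ → St n) → Fin n → ℚ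
  αplus tr j = aP (tr (suc (r j))) j

  immRej : (ℕ → St n) → Fin n → Bool
  immRej tr j = rej (tr (suc (r j))) j

module Submission where

-- Give each job j, with threshold θ_j = k·w_j·p_j, the potential
--   α_j - min(α_j, θ_j) - 4k·α_j·[j rejected].
-- Since Σ min(α_j, θ_j) ≤ k·Σ w_j p_j, it suffices that the total potential
-- is ≤ 0.  Jobs with α_j < θ_j have potential ≤ 0.  The others enter buckets
-- of T⁺; in a bucket all α agree up to a factor 4 (their ⌊α/w⌋₂ and ⌊w⌋₂
-- agree), and its 1st, (k+1)-st, (2k+1)-st, … members are rejected.  Charge
-- each member V_x (the largest α of its bucket x), and a rejected member
-- additionally -k·V_x: every bucket then has total charge ≤ 0, and each
-- job's potential is at most its charge.  Formally, along the run the total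
-- potential stays below the weight of the history of T⁺ buckets, which is ≤ 0.

open import Defs
open import Data.Nat using (ℕ; NonZero)
open import Data.Rational using (ℚ)
open import Data.Fin using (Fin)

module BinaryLogarithm where

  open import Data.Bool using (true; false; if_then_else_; T)
  open import Data.Nat as ℕ using (ℕ; zero; suc; _+_; _*_; _^_; _≤_; z≤n; s≤s)
  import Data.Nat.Properties as ℕP
  open import Data.Integer as ℤ using (ℤ; +_; -[1+_])
  import Data.Integer.Properties as ℤP
  open import Data.List using (List; []; _∷_; foldl; applyUpTo)
  open import Data.List.Properties using (map-upTo)
  open import Data.Product using (_×_; _,_; proj₁; proj₂)
  open import Data.Sum using (_⊎_; inj₁; inj₂)
  open import Data.Bool.Properties using (T-≡)
  open import Data.Empty using (⊥-elim)
  open import Function using (_∘_; Equivalence)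
  open import Relation.Binary.PropositionalEquality
  open import Data.Nat.Tactic.RingSolver using (solve-∀)

  ≤ᵇ-true : ∀ {m n} → (m ℕ.≤ᵇ n) ≡ true → m ℕ.≤ n
  ≤ᵇ-true {m} {n} e = ℕP.≤ᵇ⇒≤ m n (subst T (sym e) _)

  ≤ᵇ-false : ∀ {m n} → (m ℕ.≤ᵇ n) ≡ false → n ℕ.< m
  ≤ᵇ-false e = ℕP.≰⇒> (λ m≤n → subst T e (ℕP.≤⇒≤ᵇ m≤n))

  ≤ᵇ-true⁻¹ : ∀ {m n} → m ℕ.≤ n → (m ℕ.≤ᵇ n) ≡ true
  ≤ᵇ-true⁻¹ m≤n = Equivalence.to T-≡ (ℕP.≤⇒≤ᵇ m≤n)

  ≤ᵇ-false⁻¹ : ∀ {m n} → n ℕ.< m → (m ℕ.≤ᵇ n) ≡ false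
  ≤ᵇ-false⁻¹ {m} {n} n<m with m ℕ.≤ᵇ n in e
  ... | false = refl
  ... | true  = ⊥-elim (ℕP.<⇒≱ n<m (≤ᵇ-true e))

  n<2^n : ∀ n → n ℕ.< 2 ^ n
  n<2^n zero    = s≤s z≤n
  n<2^n (suc n) = ℕP.≤-trans (ℕP.+-mono-≤ (ℕP.m^n>0 2 n) (n<2^n n))
                             (ℕP.≤-reflexive (cong (2 ^ n ℕ.+_) (sym (ℕP.+-identityʳ (2 ^ n)))))

  data Consecutive : ℤ → List ℤ → ℤ → Set where
    stop : ∀ {c} → Consecutive c [] c
    next : ∀ {c xs e} → Consecutive (ℤ.suc c) xs e → Consecutive c (c ∷ xs) e

  applyUpTo-consecutive : ∀ N (h : ℕ → ℤ) → (∀ m → h (suc m) ≡ ℤ.suc (h m))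
                        → Consecutive (h 0) (applyUpTo h N) (h N)
  applyUpTo-consecutive zero    h step = stop
  applyUpTo-consecutive (suc N) h step =
    next (subst (λ c → Consecutive c (applyUpTo (h ∘ suc) N) (h (suc N))) (step 0)
                (applyUpTo-consecutive N (h ∘ suc) (step ∘ suc)))

  keepPassing : ℕ → ℕ → ℤ → ℤ → ℤ
  keepPassing A B acc i = if pow2Le i A B then i else acc

  -- Scanning a run c, …, e-1 of consecutive candidates keeps the invariant
  -- "acc passes the test, and acc+1 either fails it or is the next candidate".
  -- At the end acc+1 either fails or is e, so acc is maximal among tested values.
  scan-invariant : ∀ {A B c xs e} acc → Consecutive c xs e
    → pow2Le acc A B ≡ true → (ℤ.suc acc ≡ c ⊎ pow2Le (ℤ.suc acc) A B ≡ false)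
    → let res = foldl (keepPassing A B) acc xs
      in pow2Le res A B ≡ true × (ℤ.suc res ≡ e ⊎ pow2Le (ℤ.suc res) A B ≡ false)
  scan-invariant acc stop passes succ = passes , succ
  scan-invariant {A} {B} acc (next {c} run) passes succ with pow2Le c A B in c-passes
  ... | true  = scan-invariant c run c-passes (inj₁ refl)
  ... | false = scan-invariant acc run passes (inj₂ (succ-fails succ))
    where
    succ-fails : ℤ.suc acc ≡ c ⊎ pow2Le (ℤ.suc acc) A B ≡ false → pow2Le (ℤ.suc acc) A B ≡ false
    succ-fails (inj₁ refl) = c-passes
    succ-fails (inj₂ fails) = fails

  -- The scan of lg2ℕ A B starts below and ends above the answer: the first
  -- candidate -B passes (B < 2^B ≤ 2^B·A), and A+1, one past the last
  -- candidate, fails (A < 2^(A+1) ≤ 2^(A+1)·B).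
  lowest-passes : ∀ A b → 1 ≤ A → pow2Le -[1+ b ] A (suc b) ≡ true
  lowest-passes A b 1≤A =
    ≤ᵇ-true⁻¹ (ℕP.≤-trans (ℕP.<⇒≤ (n<2^n (suc b))) (ℕP.m≤m*n (2 ^ suc b) A {{ℕ.>-nonZero 1≤A}}))

  highest-fails : ∀ A B → 1 ≤ B → pow2Le (+ suc A) A B ≡ false
  highest-fails A B 1≤B =
    ≤ᵇ-false⁻¹ (ℕP.<-≤-trans (ℕP.<-trans (ℕP.n<1+n A) (n<2^n (suc A))) (ℕP.m≤m*n (2 ^ suc A) B {{ℕ.>-nonZero 1≤B}}))

  lg2ℕ-spec : ∀ A B → 1 ≤ A → 1 ≤ B
    → pow2Le (lg2ℕ A B) A B ≡ true × pow2Le (ℤ.suc (lg2ℕ A B)) A B ≡ false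
  lg2ℕ-spec A B@(suc b) 1≤A 1≤B =
    subst (λ i → pow2Le i A B ≡ true × pow2Le (ℤ.suc i) A B ≡ false) (sym lg2ℕ-as-scan)
          (proj₁ scan , last-fails (proj₂ scan))
    where
    candidate : ℕ → ℤ
    candidate m = + m ℤ.- + B
    candidate-suc : ∀ m → candidate (suc m) ≡ ℤ.suc (candidate m)
    candidate-suc m = ℤP.+-assoc (+ 1) (+ m) -[1+ b ]
    candidate-last : candidate (suc (B + A)) ≡ + suc A
    candidate-last = trans (ℤP.[+m]-[+n]≡m⊖n (suc (B + A)) B)
      (trans (cong₂ ℤ._⊖_ (sym (ℕP.+-suc B A)) (sym (ℕP.+-identityʳ B))) (ℤP.+-cancelˡ-⊖ B (suc A) 0))
    -- the scan in lg2ℕ, started at -B, is unchanged by the first candidate -B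
    result : ℤ
    result = foldl (keepPassing A B) -[1+ b ] (applyUpTo (candidate ∘ suc) (B + A))
    lg2ℕ-as-scan : lg2ℕ A B ≡ result
    lg2ℕ-as-scan = trans (cong (foldl (keepPassing A B) -[1+ b ]) (map-upTo candidate (suc (B + A))))
                         (cong (λ acc → foldl (keepPassing A B) acc (applyUpTo (candidate ∘ suc) (B + A)))
                               (keepPassing-idem -[1+ b ]))
      where
      keepPassing-idem : ∀ i → keepPassing A B i i ≡ i
      keepPassing-idem i with pow2Le i A B
      ... | true  = refl
      ... | false = refl
    scan : pow2Le result A B ≡ true
         × (ℤ.suc result ≡ candidate (suc (B + A)) ⊎ pow2Le (ℤ.suc result) A B ≡ false)
    scan = scan-invariant -[1+ b ] (applyUpTo-consecutive (B + A) (candidate ∘ suc) (candidate-suc ∘ suc))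
                          (lowest-passes A b 1≤A) (inj₁ (candidate-suc 0))
    last-fails : ℤ.suc result ≡ candidate (suc (B + A)) ⊎ pow2Le (ℤ.suc result) A B ≡ false
               → pow2Le (ℤ.suc result) A B ≡ false
    last-fails (inj₁ is-last) = trans (cong (λ i → pow2Le i A B) (trans is-last candidate-last)) (highest-fails A B 1≤B)
    last-fails (inj₂ fails)   = fails

  pow2-bracket : ∀ i {A B A' B'} → pow2Le i A B ≡ true → pow2Le (ℤ.suc i) A' B' ≡ false
               → A' * B ≤ 2 * A * B'
  pow2-bracket (+ m) {A} {B} {A'} {B'} lower upper = begin
    A' * B                ≤⟨ ℕP.*-monoˡ-≤ B (ℕP.<⇒≤ (≤ᵇ-false {2 ^ suc m * B'} upper)) ⟩
    2 * 2 ^ m * B' * B    ≡⟨ regroup (2 ^ m) B B' ⟩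
    2 * (2 ^ m * B) * B'  ≤⟨ ℕP.*-monoˡ-≤ B' (ℕP.*-monoʳ-≤ 2 (≤ᵇ-true {2 ^ m * B} lower)) ⟩
    2 * A * B'            ∎
    where
    open ℕP.≤-Reasoning
    regroup : ∀ x B B' → 2 * x * B' * B ≡ 2 * (x * B) * B'
    regroup = solve-∀
  pow2-bracket -[1+ zero ] {A} {B} {A'} {B'} lower upper = begin
    A' * B              ≤⟨ ℕP.*-mono-≤ (ℕP.<⇒≤ (≤ᵇ-false {1 * B'} upper)) (≤ᵇ-true {B} lower) ⟩
    (B' + 0) * (2 * A)  ≡⟨ regroup A B' ⟩
    2 * A * B'          ∎
    where
    open ℕP.≤-Reasoning
    regroup : ∀ A B' → (B' + 0) * (2 * A) ≡ 2 * A * B'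
    regroup = solve-∀
  pow2-bracket -[1+ suc m ] {A} {B} {A'} {B'} lower upper = begin
    A' * B                      ≤⟨ ℕP.*-monoʳ-≤ A' (≤ᵇ-true {B} lower) ⟩
    A' * (2 * (2 * 2 ^ m) * A)  ≡⟨ regroup (2 ^ m) A A' ⟩
    2 * (2 * 2 ^ m * A') * A    ≤⟨ ℕP.*-monoˡ-≤ A (ℕP.*-monoʳ-≤ 2 (ℕP.<⇒≤ (≤ᵇ-false {B'} upper))) ⟩
    2 * B' * A                  ≡⟨ swap A B' ⟩
    2 * A * B'                  ∎
    where
    open ℕP.≤-Reasoning
    regroup : ∀ x A A' → A' * (2 * (2 * x) * A) ≡ 2 * (2 * x * A') * A
    regroup = solve-∀
    swap : ∀ A B' → 2 * B' * A ≡ 2 * A * B'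
    swap = solve-∀

  lg2ℕ-ratio : ∀ {A B A' B'} → 1 ≤ A → 1 ≤ B → 1 ≤ A' → 1 ≤ B'
             → lg2ℕ A B ≡ lg2ℕ A' B' → A' * B ≤ 2 * A * B'
  lg2ℕ-ratio {A} {B} {A'} {B'} 1≤A 1≤B 1≤A' 1≤B' same =
    pow2-bracket (lg2ℕ A B) (proj₁ (lg2ℕ-spec A B 1≤A 1≤B))
      (subst (λ i → pow2Le (ℤ.suc i) A' B' ≡ false) (sym same) (proj₂ (lg2ℕ-spec A' B' 1≤A' 1≤B')))

module Rationals where

  open BinaryLogarithm
  open import Data.Nat as ℕ using (ℕ; zero; suc; z≤n; s≤s)
  open import Data.Nat using () renaming (_*_ to _·_)
  import Data.Nat.Coprimality as Coprimality
  open import Data.Integer as ℤ using (ℤ; +_; -[1+_])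
  import Data.Integer.Properties as ℤP
  open import Data.Rational as ℚ using (ℚ; mkℚ; 0ℚ; 1ℚ; _≤_; _<_; _+_; _*_; _-_; -_; *≤*; *<*; toℚᵘ)
  import Data.Rational.Properties as ℚP
  import Data.Rational.Unnormalised as ℚᵘ
  import Data.Rational.Unnormalised.Properties as ℚᵘP
  open import Relation.Binary.PropositionalEquality
  open import Data.Bool using (true; false; T)
  open import Data.Nat.Tactic.RingSolver using (solve-∀)
  open import Data.Rational.Solver using (module +-*-Solver)
  open +-*-Solver using (solve; _:+_; _:*_; _:-_; :-_; _:=_; con)

  ofℕ-mkℚ : ∀ m → ofℕ m ≡ mkℚ (+ m) 0 (Coprimality.sym (Coprimality.1-coprimeTo m))
  ofℕ-mkℚ m = ℚP.normalize-coprime (Coprimality.sym (Coprimality.1-coprimeTo m))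

  toℚᵘ-ofℕ : ∀ m → toℚᵘ (ofℕ m) ℚᵘ.≃ ℚᵘ.mkℚᵘ (+ m) 0
  toℚᵘ-ofℕ m = ℚᵘP.≃-reflexive (cong toℚᵘ (ofℕ-mkℚ m))

  ofℕ-+ : ∀ m n → ofℕ (m ℕ.+ n) ≡ ofℕ m + ofℕ n
  ofℕ-+ m n = ℚP.toℚᵘ-injective (ℚᵘP.≃-trans (toℚᵘ-ofℕ (m ℕ.+ n)) (ℚᵘP.≃-sym
    (ℚᵘP.≃-trans (ℚP.toℚᵘ-homo-+ (ofℕ m) (ofℕ n))
    (ℚᵘP.≃-trans (ℚᵘP.+-cong (toℚᵘ-ofℕ m) (toℚᵘ-ofℕ n)) (ℚᵘ.*≡* (cong (ℤ._* + 1) sum≡))))))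
    where
    sum≡ : + m ℤ.* + 1 ℤ.+ + n ℤ.* + 1 ≡ + (m ℕ.+ n)
    sum≡ = trans (cong₂ ℤ._+_ (ℤP.*-identityʳ (+ m)) (ℤP.*-identityʳ (+ n))) (sym (ℤP.pos-+ m n))

  ofℕ-* : ∀ m n → ofℕ (m ℕ.* n) ≡ ofℕ m * ofℕ n
  ofℕ-* m n = ℚP.toℚᵘ-injective (ℚᵘP.≃-trans (toℚᵘ-ofℕ (m ℕ.* n)) (ℚᵘP.≃-sym
    (ℚᵘP.≃-trans (ℚP.toℚᵘ-homo-* (ofℕ m) (ofℕ n))
    (ℚᵘP.≃-trans (ℚᵘP.*-cong (toℚᵘ-ofℕ m) (toℚᵘ-ofℕ n)) (ℚᵘ.*≡* (cong (ℤ._* + 1) (sym (ℤP.pos-* m n))))))))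

  ofℕ-mono : ∀ {m n} → m ℕ.≤ n → ofℕ m ≤ ofℕ n
  ofℕ-mono {m} {n} m≤n = subst₂ _≤_ (sym (ofℕ-mkℚ m)) (sym (ofℕ-mkℚ n))
    (*≤* (subst₂ ℤ._≤_ (sym (ℤP.*-identityʳ (+ m))) (sym (ℤP.*-identityʳ (+ n))) (ℤ.+≤+ m≤n)))

  0≤ofℕ : ∀ m → 0ℚ ≤ ofℕ m
  0≤ofℕ m = ofℕ-mono {0} {m} z≤n

  0<1ℚ : 0ℚ < 1ℚ
  0<1ℚ = *<* (ℤ.+<+ (s≤s z≤n))

  ofℕ-pos : ∀ {m} → 1 ℕ.≤ m → 0ℚ < ofℕ m
  ofℕ-pos {m} 1≤m = ℚP.<-≤-trans 0<1ℚ (ofℕ-mono {1} {m} 1≤m)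

  *-nonNeg : ∀ {p q} → 0ℚ ≤ p → 0ℚ ≤ q → 0ℚ ≤ p * q
  *-nonNeg {p} {q} 0≤p 0≤q =
    ℚP.nonNegative⁻¹ (p * q) {{ℚP.nonNeg*nonNeg⇒nonNeg p {{ℚ.nonNegative 0≤p}} q {{ℚ.nonNegative 0≤q}}}}

  *-pos : ∀ {p q} → 0ℚ < p → 0ℚ < q → 0ℚ < p * q
  *-pos {p} {q} 0<p 0<q = ℚP.positive⁻¹ (p * q) {{ℚP.pos*pos⇒pos p {{ℚ.positive 0<p}} q {{ℚ.positive 0<q}}}}

  *-monoˡ-≤ : ∀ {c p q} → 0ℚ ≤ c → p ≤ q → c * p ≤ c * q
  *-monoˡ-≤ {c} 0≤c = ℚP.*-monoˡ-≤-nonNeg c {{ℚ.nonNegative 0≤c}}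

  ≤⇒-≤0 : ∀ {p q} → p ≤ q → p - q ≤ 0ℚ
  ≤⇒-≤0 {p} {q} p≤q = subst (p - q ≤_) (ℚP.+-inverseʳ q) (ℚP.+-monoˡ-≤ (- q) p≤q)

  ≤⇒0≤- : ∀ {p q} → p ≤ q → 0ℚ ≤ q - p
  ≤⇒0≤- {p} {q} p≤q = subst (_≤ q - p) (ℚP.+-inverseʳ p) (ℚP.+-monoˡ-≤ (- p) p≤q)

  0≤-⇒≤ : ∀ {p q} → 0ℚ ≤ q - p → p ≤ q
  0≤-⇒≤ {p} {q} 0≤q-p = subst₂ _≤_ (ℚP.+-identityʳ p) (cancel p q) (ℚP.+-monoʳ-≤ p 0≤q-p)
    where
    cancel : ∀ p q → p + (q - p) ≡ q
    cancel = solve 2 (λ p q → p :+ (q :- p) := q) refl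

  ℚ≤ᵇ-true : ∀ {p q} → (p ℚ.≤ᵇ q) ≡ true → p ≤ q
  ℚ≤ᵇ-true e = ℚP.≤ᵇ⇒≤ (subst T (sym e) _)

  ℚ≤ᵇ-false : ∀ {p q} → (p ℚ.≤ᵇ q) ≡ false → q < p
  ℚ≤ᵇ-false e = ℚP.≰⇒> (λ p≤q → subst T e (ℚP.≤⇒≤ᵇ p≤q))

  data PositiveForm : ℚ → Set where
    positiveForm : ∀ m d .(c : Coprimality.Coprime (suc m) (suc d)) → PositiveForm (mkℚ (+ suc m) d c)

  positiveForm? : ∀ {q} → 0ℚ < q → PositiveForm q
  positiveForm? {mkℚ (+ suc m) d c} _ = positiveForm m d c
  positiveForm? {mkℚ (+ zero) d c} (*<* (ℤ.+<+ ()))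
  positiveForm? {mkℚ -[1+ m ] d c} (*<* ())

  lg2-ratio : ∀ {a b a' b'} → 0ℚ < a → 0ℚ < b → 0ℚ < a' → 0ℚ < b'
            → lg2 a b ≡ lg2 a' b' → a' * b ≤ ofℕ 2 * a * b'
  lg2-ratio {a} {b} {a'} {b'} 0<a 0<b 0<a' 0<b' same
    with positiveForm? 0<a | positiveForm? 0<b | positiveForm? 0<a' | positiveForm? 0<b'
  ... | positiveForm an ad _ | positiveForm bn bd _ | positiveForm an' ad' _ | positiveForm bn' bd' _ =
    ℚP.toℚᵘ-cancel-≤ (ℚᵘP.≤-respˡ-≃ (ℚᵘP.≃-sym (ℚP.toℚᵘ-homo-* a' b))
                       (ℚᵘP.≤-respʳ-≃ (ℚᵘP.≃-sym (ℚᵘP.≃-trans (ℚP.toℚᵘ-homo-* (ofℕ 2 * a) b')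
                                                    (ℚᵘP.*-congʳ (ℚP.toℚᵘ-homo-* (ofℕ 2) a))))
                         (ℚᵘ.*≤* (ℤ.+≤+ cross))))
    where
    lg2-cross : (suc an' · suc bd') · (suc ad · suc bn) ℕ.≤ 2 · (suc an · suc bd) · (suc ad' · suc bn')
    lg2-cross = lg2ℕ-ratio {suc an · suc bd} {suc ad · suc bn} {suc an' · suc bd'} {suc ad' · suc bn'}
                           (s≤s z≤n) (s≤s z≤n) (s≤s z≤n) (s≤s z≤n) same
    cross : (suc an' · suc bn) · (1 · suc ad · suc bd') ℕ.≤ (2 · suc an · suc bn') · (suc ad' · suc bd)
    cross = subst₂ ℕ._≤_ (lhs (suc an') (suc bd') (suc ad) (suc bn)) (rhs (suc an) (suc bd) (suc ad') (suc bn'))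
                   lg2-cross
      where
      lhs : ∀ x y z u → (x · y) · (z · u) ≡ (x · u) · (1 · z · y)
      lhs = solve-∀
      rhs : ∀ x y z u → 2 · (x · y) · (z · u) ≡ (2 · x · u) · (z · y)
      rhs = solve-∀

  -- Jobs sharing a T⁺ bucket, i.e. with equal ⌊α/w⌋₂ and equal ⌊w⌋₂, have
  -- values α within a factor 4 of each other.
  sameBucket-≤4 : ∀ {α w α' w'} → 0ℚ < α → 0ℚ < w → 0ℚ < α' → 0ℚ < w'
                → lg2 α w ≡ lg2 α' w' → ⌊ w ⌋₂ ≡ ⌊ w' ⌋₂ → α' ≤ ofℕ 4 * α
  sameBucket-≤4 {α} {w} {α'} {w'} 0<α 0<w 0<α' 0<w' sameRatio sameWeight =
    ℚP.*-cancelʳ-≤-pos w {{ℚ.positive 0<w}} (begin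
      α' * w                   ≤⟨ lg2-ratio 0<α 0<w 0<α' 0<w' sameRatio ⟩
      ofℕ 2 * α * w'           ≤⟨ *-monoˡ-≤ (*-nonNeg (0≤ofℕ 2) (ℚP.<⇒≤ 0<α)) w'≤2w ⟩
      ofℕ 2 * α * (ofℕ 2 * w)  ≡⟨ regroup α w ⟩
      ofℕ 4 * α * w            ∎)
    where
    open ℚP.≤-Reasoning
    w'≤2w : w' ≤ ofℕ 2 * w
    w'≤2w = subst₂ _≤_ (ℚP.*-identityʳ w') (ℚP.*-identityʳ (ofℕ 2 * w))
                        (lg2-ratio 0<w 0<1ℚ 0<w' 0<1ℚ sameWeight)
    regroup : ∀ α w → ofℕ 2 * α * (ofℕ 2 * w) ≡ ofℕ 4 * α * w
    regroup = solve 2 (λ α w → con (ofℕ 2) :* α :* (con (ofℕ 2) :* w) := con (ofℕ 4) :* α :* w) refl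

module FiniteSums where

  open import Data.Nat as ℕ using (ℕ; zero; suc)
  import Data.Nat.Properties as ℕP
  open import Data.Rational using (ℚ; 0ℚ; _≤_; _+_; _*_; _⊔_)
  import Data.Rational.Properties as ℚP
  open import Data.Bool using (Bool; true; false; if_then_else_)
  open import Data.Fin using (Fin; zero; suc; punchIn)
  open import Data.Fin.Properties using (punchInᵢ≢i)
  open import Data.List using (foldr; tabulate)
  open import Algebra.Bundles using (Ring)
  open import Relation.Nullary using (¬_)
  open import Function using (_∘_; id)
  open import Relation.Binary.PropositionalEquality

  open import Algebra.Properties.Semiring.Sum (Ring.semiring ℚP.+-*-ring)
    using (sum; sum-cong-≗; sum-replicate-zero; sum-remove; ∑-distrib-+; *-distribˡ-sum) public

  Σℚ≡sum : ∀ n (f : Fin n → ℚ) → Σℚ n f ≡ sum f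
  Σℚ≡sum n f = tabulate-sum n id
    where
    tabulate-sum : ∀ m (h : Fin m → Fin n) → foldr (λ i acc → f i + acc) 0ℚ (tabulate h) ≡ sum (f ∘ h)
    tabulate-sum zero    h = refl
    tabulate-sum (suc m) h = cong (f (h zero) +_) (tabulate-sum m (h ∘ suc))

  keepIf : Bool → ℚ → ℚ
  keepIf r a = if r then a else 0ℚ

  keepIf-nonNeg : ∀ r {a} → 0ℚ ≤ a → 0ℚ ≤ keepIf r a
  keepIf-nonNeg true  0≤a = 0≤a
  keepIf-nonNeg false 0≤a = ℚP.≤-refl

  sum-mono : ∀ {n} {f g : Fin n → ℚ} → (∀ i → f i ≤ g i) → sum f ≤ sum g
  sum-mono {zero}  f≤g = ℚP.≤-refl
  sum-mono {suc n} f≤g = ℚP.+-mono-≤ (f≤g zero) (sum-mono (f≤g ∘ suc))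

  sum-nonNeg : ∀ {n} (f : Fin n → ℚ) → (∀ i → 0ℚ ≤ f i) → 0ℚ ≤ sum f
  sum-nonNeg {n} f 0≤f = subst (_≤ sum f) (sum-replicate-zero n) (sum-mono 0≤f)

  sum-nonPos : ∀ {n} (f : Fin n → ℚ) → (∀ i → f i ≤ 0ℚ) → sum f ≤ 0ℚ
  sum-nonPos {n} f f≤0 = subst (sum f ≤_) (sum-replicate-zero n) (sum-mono f≤0)

  Σℚ[]-nonNeg : ∀ {n} (P : Fin n → Bool) f → (∀ i → 0ℚ ≤ f i) → 0ℚ ≤ Σℚ[ P ] f
  Σℚ[]-nonNeg {n} P f 0≤f = subst (0ℚ ≤_) (sym (Σℚ≡sum n _)) (sum-nonNeg _ (λ i → keepIf-nonNeg (P i) (0≤f i)))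

  sum-update : ∀ {n} (f g : Fin n → ℚ) x → (∀ i → ¬ i ≡ x → g i ≡ f i) → f x ≡ 0ℚ
             → sum g ≡ sum f + g x
  sum-update {suc n} f g x others fx≡0 = begin
    sum g                                ≡⟨ sum-remove {i = x} g ⟩
    g x + sum (g ∘ punchIn x)            ≡⟨ cong (g x +_) (sum-cong-≗ (λ j → others _ (punchInᵢ≢i x j))) ⟩
    g x + sum (f ∘ punchIn x)            ≡⟨ ℚP.+-comm (g x) _ ⟩
    sum (f ∘ punchIn x) + g x            ≡⟨ cong (_+ g x) f-sum ⟨
    sum f + g x                          ∎
    where
    open ≡-Reasoning
    f-sum : sum f ≡ sum (f ∘ punchIn x)
    f-sum = trans (sum-remove {i = x} f) (trans (cong (_+ sum (f ∘ punchIn x)) fx≡0) (ℚP.+-identityˡ _))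

  maxℚ : (n : ℕ) → (Fin n → ℚ) → ℚ
  maxℚ zero    f = 0ℚ
  maxℚ (suc n) f = f zero ⊔ maxℚ n (f ∘ suc)

  maxℚ-upper : ∀ n (f : Fin n → ℚ) i → f i ≤ maxℚ n f
  maxℚ-upper (suc n) f zero    = ℚP.p≤p⊔q (f zero) _
  maxℚ-upper (suc n) f (suc i) = ℚP.≤-trans (maxℚ-upper n (f ∘ suc) i) (ℚP.p≤q⊔p (f zero) _)

  maxℚ-least : ∀ n (f : Fin n → ℚ) {c} → 0ℚ ≤ c → (∀ i → f i ≤ c) → maxℚ n f ≤ c
  maxℚ-least zero    f 0≤c f≤c = 0≤c
  maxℚ-least (suc n) f 0≤c f≤c = ℚP.⊔-lub (f≤c zero) (maxℚ-least n (f ∘ suc) 0≤c (f≤c ∘ suc))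

  maxℚ-nonNeg : ∀ n (f : Fin n → ℚ) → 0ℚ ≤ maxℚ n f
  maxℚ-nonNeg zero    f = ℚP.≤-refl
  maxℚ-nonNeg (suc n) f = ℚP.≤-trans (maxℚ-nonNeg n (f ∘ suc)) (ℚP.p≤q⊔p (f zero) _)

  natSum : (n : ℕ) → (Fin n → ℕ) → ℕ
  natSum zero    f = 0
  natSum (suc n) f = f zero ℕ.+ natSum n (f ∘ suc)

  natSum-upper : ∀ n (f : Fin n → ℕ) i → f i ℕ.≤ natSum n f
  natSum-upper (suc n) f zero    = ℕP.m≤m+n (f zero) _
  natSum-upper (suc n) f (suc i) = ℕP.≤-trans (natSum-upper n (f ∘ suc) i) (ℕP.m≤n+m _ (f zero))

module Buckets where

  open Rationals
  open import Data.Bool using (true; false; if_then_else_; not)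
  open import Data.Nat as ℕ using (ℕ; zero; suc; z≤n; s≤s)
  import Data.Nat.Properties as ℕP
  open import Data.Nat.Divisibility using (_∣_; _∣?_; _∣0; m∣m*n)
  open import Data.Integer as ℤ using (ℤ)
  open import Data.Rational using (ℚ; 0ℚ; 1ℚ; _≤_; _+_; _*_; _-_; -_)
  import Data.Rational.Properties as ℚP
  open import Data.List using (List; []; _∷_; _++_; length; filterᵇ)
  open import Data.List.Properties using (length-filter)
  open import Data.Product using (_×_; _,_; proj₁)
  open import Data.Sum using (inj₁; inj₂)
  open import Data.Empty using (⊥-elim)
  open import Relation.Nullary using (¬_; yes; no)
  open import Relation.Nullary.Decidable using (⌊_⌋)
  open import Relation.Binary.PropositionalEquality
  open import Data.Rational.Solver using (module +-*-Solver)
  open +-*-Solver using (solve; _:+_; _:*_; _:-_; :-_; _:=_; con)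

  eqℤ-refl : ∀ a → eqℤ a a ≡ true
  eqℤ-refl a with a ℤ.≟ a
  ... | yes _ = refl
  ... | no a≢a = ⊥-elim (a≢a refl)

  eqℤ-sound : ∀ {a b} → eqℤ a b ≡ true → a ≡ b
  eqℤ-sound {a} {b} _  with a ℤ.≟ b
  eqℤ-sound         _  | yes a≡b = a≡b
  eqℤ-sound         () | no _

  eqP-refl : ∀ x → eqP x x ≡ true
  eqP-refl (a , b) rewrite eqℤ-refl a | eqℤ-refl b = refl

  eqP-sound : ∀ {x y} → eqP x y ≡ true → x ≡ y
  eqP-sound {a , b} {c , d} _  with eqℤ a c in ac | eqℤ b d in bd
  eqP-sound                 _  | true  | true = cong₂ _,_ (eqℤ-sound ac) (eqℤ-sound bd)
  eqP-sound                 () | true  | false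
  eqP-sound                 () | false | _

  eqP-sym : ∀ x y → eqP x y ≡ eqP y x
  eqP-sym x y with eqP x y in xy | eqP y x in yx
  ... | true  | true  = refl
  ... | false | false = refl
  ... | true  | false with refl ← eqP-sound {x} {y} xy = trans (sym (eqP-refl x)) yx
  ... | false | true  with refl ← eqP-sound {y} {x} yx = trans (sym xy) (eqP-refl x)

  -- Counting rejections inside one T⁺ bucket.  The jobs of a bucket are
  -- numbered 0, 1, 2, … in arrival order; job c is rejected iff k ∣ c.
  module BucketCounting (k : ℕ) where

    rejectedAt : ℕ → ℕ
    rejectedAt c = if ⌊ k ∣? c ⌋ then 1 else 0

    charge : ℕ → ℚ
    charge c = 1ℚ - ofℕ (k ℕ.* rejectedAt c)

    charge-rejected : ∀ {c} → ⌊ k ∣? c ⌋ ≡ true → charge c ≡ 1ℚ - ofℕ k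
    charge-rejected k∣c rewrite k∣c = cong (λ m → 1ℚ - ofℕ m) (ℕP.*-identityʳ k)

    charge-accepted : ∀ {c} → ⌊ k ∣? c ⌋ ≡ false → charge c ≡ 1ℚ
    charge-accepted k∤c rewrite k∤c = cong (λ m → 1ℚ - ofℕ m) (ℕP.*-zeroʳ k)

    rejections : ℕ → ℕ → ℕ
    rejections a zero    = 0
    rejections a (suc m) = rejectedAt a ℕ.+ rejections (suc a) m

    runCharge : ℕ → ℕ → ℚ
    runCharge a zero    = 0ℚ
    runCharge a (suc m) = charge a + runCharge (suc a) m

    runCharge≡ : ∀ a m → runCharge a m ≡ ofℕ m - ofℕ (k ℕ.* rejections a m)
    runCharge≡ a zero    = cong (λ z → 0ℚ - ofℕ z) (sym (ℕP.*-zeroʳ k))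
    runCharge≡ a (suc m) = begin
      charge a + runCharge (suc a) m
        ≡⟨ cong (charge a +_) (runCharge≡ (suc a) m) ⟩
      (1ℚ - ofℕ (k ℕ.* rejectedAt a)) + (ofℕ m - ofℕ (k ℕ.* rejections (suc a) m))
        ≡⟨ regroup (ofℕ (k ℕ.* rejectedAt a)) (ofℕ m) (ofℕ (k ℕ.* rejections (suc a) m)) ⟩
      (1ℚ + ofℕ m) - (ofℕ (k ℕ.* rejectedAt a) + ofℕ (k ℕ.* rejections (suc a) m))
        ≡⟨ cong₂ _-_ (sym (ofℕ-+ 1 m)) (trans (sym (ofℕ-+ (k ℕ.* rejectedAt a) _)) (cong ofℕ (sym (ℕP.*-distribˡ-+ k (rejectedAt a) (rejections (suc a) m))))) ⟩
      ofℕ (suc m) - ofℕ (k ℕ.* rejections a (suc m))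
        ∎
      where
      open ≡-Reasoning
      regroup : ∀ x y z → (1ℚ - x) + (y - z) ≡ (1ℚ + y) - (x + z)
      regroup = solve 3 (λ x y z → (con 1ℚ :- x) :+ (y :- z) := (con 1ℚ :+ y) :- (x :+ z)) refl

    rejections-snoc : ∀ a m → rejections a (suc m) ≡ rejections a m ℕ.+ rejectedAt (a ℕ.+ m)
    rejections-snoc a zero    = trans (ℕP.+-identityʳ _) (cong rejectedAt (sym (ℕP.+-identityʳ a)))
    rejections-snoc a (suc m) = trans (cong (rejectedAt a ℕ.+_) (rejections-snoc (suc a) m))
      (trans (sym (ℕP.+-assoc (rejectedAt a) (rejections (suc a) m) _))
             (cong (λ z → rejections a (suc m) ℕ.+ rejectedAt z) (sym (ℕP.+-suc a m))))

    rejectedAt-yes : ∀ {c} → k ∣ c → rejectedAt c ≡ 1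
    rejectedAt-yes {c} k∣c with k ∣? c
    ... | yes _   = refl
    ... | no k∤c  = ⊥-elim (k∤c k∣c)

    rejectedAt-no : ∀ {c} → ¬ k ∣ c → rejectedAt c ≡ 0
    rejectedAt-no {c} k∤c with k ∣? c
    ... | yes k∣c = ⊥-elim (k∤c k∣c)
    ... | no _    = refl

    enough-rejections : 2 ℕ.≤ k → ∀ m → m ℕ.≤ k ℕ.* rejections 0 m × (¬ k ∣ m → m ℕ.< k ℕ.* rejections 0 m)
    enough-rejections 2≤k zero = z≤n , λ k∤0 → ⊥-elim (k∤0 (k ∣0))
    enough-rejections 2≤k (suc m) with enough-rejections 2≤k m | k ∣? m
    ... | (m≤kR , _) | yes k∣m = ℕP.<⇒≤ bound , λ _ → bound
      where
      R = rejections 0 m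
      bound : suc m ℕ.< k ℕ.* rejections 0 (suc m)
      bound = begin-strict
        suc m                ≡⟨ ℕP.+-comm 1 m ⟩
        m ℕ.+ 1              <⟨ ℕP.+-monoʳ-< m 2≤k ⟩
        m ℕ.+ k              ≤⟨ ℕP.+-monoˡ-≤ k m≤kR ⟩
        k ℕ.* R ℕ.+ k        ≡⟨ cong (k ℕ.* R ℕ.+_) (ℕP.*-identityʳ k) ⟨
        k ℕ.* R ℕ.+ k ℕ.* 1  ≡⟨ ℕP.*-distribˡ-+ k R 1 ⟨
        k ℕ.* (R ℕ.+ 1)      ≡⟨ cong (k ℕ.*_) (trans (rejections-snoc 0 m) (cong (R ℕ.+_) (rejectedAt-yes k∣m))) ⟨
        k ℕ.* rejections 0 (suc m) ∎
        where open ℕP.≤-Reasoning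
    ... | (_ , m<kR) | no k∤m = 1+m≤kR , strict
      where
      unchanged : rejections 0 (suc m) ≡ rejections 0 m
      unchanged = trans (rejections-snoc 0 m) (trans (cong (rejections 0 m ℕ.+_) (rejectedAt-no k∤m)) (ℕP.+-identityʳ _))
      1+m≤kR : suc m ℕ.≤ k ℕ.* rejections 0 (suc m)
      1+m≤kR = subst (λ R → suc m ℕ.≤ k ℕ.* R) (sym unchanged) (m<kR k∤m)
      strict : ¬ k ∣ suc m → suc m ℕ.< k ℕ.* rejections 0 (suc m)
      strict k∤1+m with ℕP.m≤n⇒m<n∨m≡n 1+m≤kR
      ... | inj₁ 1+m<kR = 1+m<kR
      ... | inj₂ 1+m≡kR = ⊥-elim (k∤1+m (subst (k ∣_) (sym 1+m≡kR) (m∣m*n (rejections 0 (suc m)))))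

    runCharge-nonPos : 2 ℕ.≤ k → ∀ m → runCharge 0 m ≤ 0ℚ
    runCharge-nonPos 2≤k m = subst (_≤ 0ℚ) (sym (runCharge≡ 0 m))
      (≤⇒-≤0 (ofℕ-mono (proj₁ (enough-rejections 2≤k m))))

  -- The weight of a T⁺ history, i.e. of the list of bucket keys assigned so far
  -- in arrival order: an entry with key x that is the c-th entry of its bucket
  -- contributes V x · charge c.  Grouping the entries by bucket, the weight is
  -- a sum of terms V x · runCharge 0 (size of bucket x), hence it is ≤ 0.
  module HistoryWeight (k : ℕ) (V : KeyP → ℚ) where
    open BucketCounting k public

    bump : KeyP → (KeyP → ℕ) → KeyP → ℕ
    bump y g z = if eqP z y then suc (g z) else g z

    -- weight of a history when g x entries of each bucket x precede it
    weightFrom : (KeyP → ℕ) → List KeyP → ℚ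
    weightFrom g []      = 0ℚ
    weightFrom g (y ∷ h) = V y * charge (g y) + weightFrom (bump y g) h

    weight : List KeyP → ℚ
    weight = weightFrom (λ _ → 0)

    weightFrom-snoc : ∀ g h x → weightFrom g (h ++ x ∷ []) ≡ weightFrom g h + V x * charge (g x ℕ.+ count eqP x h)
    weightFrom-snoc g []      x = trans (ℚP.+-identityʳ _)
      (trans (cong (λ c → V x * charge c) (sym (ℕP.+-identityʳ (g x)))) (sym (ℚP.+-identityˡ _)))
    weightFrom-snoc g (y ∷ h) x = trans (cong (V y * charge (g y) +_) (weightFrom-snoc (bump y g) h x))
      (trans (sym (ℚP.+-assoc (V y * charge (g y)) (weightFrom (bump y g) h) _))
             (cong (λ c → weightFrom g (y ∷ h) + V x * charge c) counters))
      where
      counters : bump y g x ℕ.+ count eqP x h ≡ g x ℕ.+ count eqP x (y ∷ h)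
      counters with eqP x y
      ... | true  = sym (ℕP.+-suc (g x) (count eqP x h))
      ... | false = refl

    weight-snoc : ∀ h x → weight (h ++ x ∷ []) ≡ weight h + V x * charge (count eqP x h)
    weight-snoc = weightFrom-snoc (λ _ → 0)

    without : KeyP → List KeyP → List KeyP
    without x = filterᵇ (λ y → not (eqP x y))

    weightFrom-without : ∀ x h g g' → (∀ z → eqP x z ≡ false → g z ≡ g' z)
                       → weightFrom g (without x h) ≡ weightFrom g' (without x h)
    weightFrom-without x []      g g' agree = refl
    weightFrom-without x (y ∷ h) g g' agree with eqP x y in xy
    ... | true  = weightFrom-without x h g g' agree
    ... | false = cong₂ _+_ (cong (λ c → V y * charge c) (agree y xy))
                            (weightFrom-without x h (bump y g) (bump y g') agree')
      where
      agree' : ∀ z → eqP x z ≡ false → bump y g z ≡ bump y g' z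
      agree' z xz with eqP z y
      ... | true  = cong suc (agree z xz)
      ... | false = agree z xz

    weight-split : ∀ x h g → weightFrom g h ≡ weightFrom g (without x h) + V x * runCharge (g x) (count eqP x h)
    weight-split x []      g = sym (trans (cong (0ℚ +_) (ℚP.*-zeroʳ (V x))) (ℚP.+-identityʳ 0ℚ))
    weight-split x (y ∷ h) g with eqP x y in xy
    ... | true with refl ← eqP-sound {x} {y} xy = begin
      V x * charge (g x) + weightFrom (bump x g) h
        ≡⟨ cong (V x * charge (g x) +_) (weight-split x h (bump x g)) ⟩
      V x * charge (g x) + (weightFrom (bump x g) (without x h) + V x * runCharge (bump x g x) (count eqP x h))
        ≡⟨ cong₂ (λ a c → V x * charge (g x) + (a + V x * runCharge c (count eqP x h)))
                 (weightFrom-without x h (bump x g) g bump-elsewhere) bump-here ⟩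
      V x * charge (g x) + (weightFrom g (without x h) + V x * runCharge (suc (g x)) (count eqP x h))
        ≡⟨ regroup (V x) (charge (g x)) (weightFrom g (without x h)) (runCharge (suc (g x)) (count eqP x h)) ⟩
      weightFrom g (without x h) + V x * (charge (g x) + runCharge (suc (g x)) (count eqP x h))
        ∎
      where
      open ≡-Reasoning
      bump-elsewhere : ∀ z → eqP x z ≡ false → bump x g z ≡ g z
      bump-elsewhere z xz rewrite eqP-sym z x | xz = refl
      bump-here : bump x g x ≡ suc (g x)
      bump-here rewrite eqP-refl x = refl
      regroup : ∀ v a b c → v * a + (b + v * c) ≡ b + v * (a + c)
      regroup = solve 4 (λ v a b c → v :* a :+ (b :+ v :* c) := b :+ v :* (a :+ c)) refl
    ... | false = begin
      V y * charge (g y) + weightFrom (bump y g) h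
        ≡⟨ cong (V y * charge (g y) +_) (weight-split x h (bump y g)) ⟩
      V y * charge (g y) + (weightFrom (bump y g) (without x h) + V x * runCharge (bump y g x) (count eqP x h))
        ≡⟨ cong (λ c → V y * charge (g y) + (weightFrom (bump y g) (without x h) + V x * runCharge c (count eqP x h))) bump-other ⟩
      V y * charge (g y) + (weightFrom (bump y g) (without x h) + V x * runCharge (g x) (count eqP x h))
        ≡⟨ ℚP.+-assoc (V y * charge (g y)) _ _ ⟨
      (V y * charge (g y) + weightFrom (bump y g) (without x h)) + V x * runCharge (g x) (count eqP x h)
        ∎
      where
      open ≡-Reasoning
      bump-other : bump y g x ≡ g x
      bump-other rewrite xy = refl

    weight-nonPos : 2 ℕ.≤ k → (∀ x → 0ℚ ≤ V x) → ∀ h → weight h ≤ 0ℚ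
    weight-nonPos 2≤k 0≤V h = bounded (length h) h ℕP.≤-refl
      where
      bounded : ∀ N h → length h ℕ.≤ N → weight h ≤ 0ℚ
      bounded N       []      _ = ℚP.≤-refl
      bounded (suc N) (x ∷ h) (s≤s |h|≤N) = begin
        weight (x ∷ h)
          ≡⟨ weight-split x (x ∷ h) (λ _ → 0) ⟩
        weight (without x (x ∷ h)) + V x * runCharge 0 (count eqP x (x ∷ h))
          ≤⟨ ℚP.+-mono-≤ rest-nonPos bucket-nonPos ⟩
        0ℚ + 0ℚ
          ∎
        where
        open ℚP.≤-Reasoning
        rest-nonPos : weight (without x (x ∷ h)) ≤ 0ℚ
        rest-nonPos rewrite eqP-refl x = bounded N (without x h) (ℕP.≤-trans (length-filter _ h) |h|≤N)
        bucket-nonPos : V x * runCharge 0 (count eqP x (x ∷ h)) ≤ 0ℚ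
        bucket-nonPos = subst (V x * runCharge 0 (count eqP x (x ∷ h)) ≤_) (ℚP.*-zeroʳ (V x))
                          (*-monoˡ-≤ (0≤V x) (runCharge-nonPos 2≤k (count eqP x (x ∷ h))))

module Potentials where

  open Rationals
  open FiniteSums
  open import Data.Bool using (Bool; true; false)
  open import Data.Nat as ℕ using (ℕ; z≤n; s≤s)
  import Data.Nat.Properties as ℕP
  open import Data.Rational as ℚ using (ℚ; 0ℚ; 1ℚ; _≤_; _+_; _*_; _-_; -_; _⊓_)
  import Data.Rational.Properties as ℚP
  open import Data.Fin using (Fin)
  open import Relation.Binary.PropositionalEquality
  open import Data.Rational.Solver using (module +-*-Solver)
  open +-*-Solver using (solve; _:+_; _:*_; _:-_; :-_; _:=_; con)

  -- Summed over all jobs it is ≤ 0 at the end of a run, which is the theorem.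
  potential : ℕ → ℚ → ℚ → Bool → ℚ
  potential k th a r = a - (a ⊓ th) - ofℕ 4 * ofℕ k * keepIf r a

  potential-unarrived : ∀ k {th} → 0ℚ ≤ th → potential k th 0ℚ false ≡ 0ℚ
  potential-unarrived k 0≤th rewrite ℚP.p≤q⇒p⊓q≡p 0≤th | ℚP.*-zeroʳ (ofℕ 4 * ofℕ k) = refl

  potential-below : ∀ k {th a} r → 0ℚ ≤ a → a ≤ th → potential k th a r ≤ 0ℚ
  potential-below k {th} {a} r 0≤a a≤th rewrite ℚP.p≤q⇒p⊓q≡p a≤th =
    subst (_≤ 0ℚ) (sym (cancel a z)) (ℚP.neg-antimono-≤ (*-nonNeg (*-nonNeg (0≤ofℕ 4) (0≤ofℕ k)) (keepIf-nonNeg r 0≤a)))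
    where
    z = ofℕ 4 * ofℕ k * keepIf r a
    cancel : ∀ a z → a - a - z ≡ - z
    cancel = solve 2 (λ a z → a :- a :- z := :- z) refl

  potential-accepted : ∀ k {th a V} r → 0ℚ ≤ a → 0ℚ ≤ th → a ≤ V → potential k th a r ≤ V
  potential-accepted k {th} {a} {V} r 0≤a 0≤th a≤V = ℚP.≤-trans (0≤-⇒≤ (subst (0ℚ ≤_) (sym (drop a m z)) 0≤m+z)) a≤V
    where
    m = a ⊓ th
    z = ofℕ 4 * ofℕ k * keepIf r a
    0≤m+z : 0ℚ ≤ m + z
    0≤m+z = ℚP.+-mono-≤ (ℚP.⊓-glb 0≤a 0≤th) (*-nonNeg (*-nonNeg (0≤ofℕ 4) (0≤ofℕ k)) (keepIf-nonNeg r 0≤a))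
    drop : ∀ a m z → a - (a - m - z) ≡ m + z
    drop = solve 3 (λ a m z → a :- (a :- m :- z) := m :+ z) refl

  potential-rejected : ∀ k {th a V} → 2 ℕ.≤ k → 0ℚ ≤ a → 0ℚ ≤ th → V ≤ ofℕ 4 * a
                     → potential k th a true ≤ V * (1ℚ - ofℕ k)
  potential-rejected k {th} {a} {V} 2≤k 0≤a 0≤th V≤4a = 0≤-⇒≤ (subst (0ℚ ≤_) (sym (slack V a (ofℕ k) m)) 0≤slack)
    where
    m = a ⊓ th
    0≤slack : 0ℚ ≤ (ofℕ 4 * a - V) * (ofℕ k - 1ℚ) + (ofℕ 3 * a + m)
    0≤slack = ℚP.+-mono-≤ (*-nonNeg (≤⇒0≤- V≤4a) (≤⇒0≤- (ofℕ-mono {1} {k} (ℕP.≤-trans (s≤s z≤n) 2≤k))))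
                          (ℚP.+-mono-≤ (*-nonNeg (0≤ofℕ 3) 0≤a) (ℚP.⊓-glb 0≤a 0≤th))
    slack : ∀ V a K m → V * (1ℚ - K) - (a - m - ofℕ 4 * K * a) ≡ (ofℕ 4 * a - V) * (K - 1ℚ) + (ofℕ 3 * a + m)
    slack = solve 4 (λ V a K m → V :* (con 1ℚ :- K) :- (a :- m :- con (ofℕ 4) :* K :* a)
                             := (con (ofℕ 4) :* a :- V) :* (K :- con 1ℚ) :+ (con (ofℕ 3) :* a :+ m)) refl

  -- If the potentials of n jobs with thresholds k·W j sum to at most 0, then
  -- Σ α ≤ 4k·(Σ W + Σ_{rejected} α): each α is its potential plus at most k·W
  -- plus 4k·α for a rejected job.
  potential-sum-bound : ∀ k n (α th W : Fin n → ℚ) (rej : Fin n → Bool)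
    → (∀ j → th j ≡ ofℕ k * W j) → (∀ j → 0ℚ ≤ W j)
    → sum (λ j → potential k (th j) (α j) (rej j)) ≤ 0ℚ
    → sum α ≤ ofℕ 4 * ofℕ k * (sum W + sum (λ j → keepIf (rej j) (α j)))
  potential-sum-bound k n α th W rej th≡kW 0≤W total≤0 = begin
    sum α
      ≡⟨ sum-cong-≗ (λ j → decompose (α j) (α j ⊓ th j) (keepIf (rej j) (α j))) ⟩
    sum (λ j → Φ j + (α j ⊓ th j + c * β j))
      ≡⟨ trans (∑-distrib-+ Φ _) (cong (sum Φ +_) (trans (∑-distrib-+ (λ j → α j ⊓ th j) (λ j → c * β j))
                                                           (cong (sum (λ j → α j ⊓ th j) +_) (sym (*-distribˡ-sum c β))))) ⟩
    sum Φ + (sum (λ j → α j ⊓ th j) + c * sum β)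
      ≤⟨ ℚP.+-mono-≤ total≤0 (ℚP.+-monoˡ-≤ (c * sum β) capped) ⟩
    0ℚ + (ofℕ k * sum W + c * sum β)
      ≤⟨ ℚP.+-monoʳ-≤ 0ℚ (ℚP.+-monoˡ-≤ (c * sum β) (ℚP.*-monoʳ-≤-nonNeg (sum W) {{ℚ.nonNegative (sum-nonNeg W 0≤W)}} k≤4k)) ⟩
    0ℚ + (c * sum W + c * sum β)
      ≡⟨ trans (ℚP.+-identityˡ _) (sym (ℚP.*-distribˡ-+ c (sum W) (sum β))) ⟩
    c * (sum W + sum β)
      ∎
    where
    open ℚP.≤-Reasoning
    c = ofℕ 4 * ofℕ k
    β = λ j → keepIf (rej j) (α j)
    Φ = λ j → potential k (th j) (α j) (rej j)
    decompose : ∀ a m b → a ≡ (a - m - c * b) + (m + c * b)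
    decompose a m b = solve 4 (λ a m b c → a := (a :- m :- c :* b) :+ (m :+ c :* b)) refl a m b c
    capped : sum (λ j → α j ⊓ th j) ≤ ofℕ k * sum W
    capped = subst (sum (λ j → α j ⊓ th j) ≤_) (sym (*-distribˡ-sum (ofℕ k) W))
               (sum-mono (λ j → subst (α j ⊓ th j ≤_) (th≡kW j) (ℚP.p⊓q≤q (α j) (th j))))
    k≤4k : ofℕ k ≤ c
    k≤4k = subst (ofℕ k ≤_) (ofℕ-* 4 k) (ofℕ-mono (ℕP.m≤n*m k 4))

module RunAnalysis (k n : ℕ) (r p : Fin n → ℕ) (w : Fin n → ℚ) (pNZ : (j : Fin n) → NonZero (p j)) where

  open Rationals
  open FiniteSums
  open Buckets
  open Potentials
  open import Data.Bool using (Bool; true; false; if_then_else_; _∧_; _∨_; not)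
  open import Data.Nat as ℕ using (zero; suc; z≤n; s≤s)
  import Data.Nat.Properties as ℕP
  open import Data.Nat.Divisibility using (_∣?_)
  open import Data.Rational as ℚ using (0ℚ; _≤_; _<_; _+_; _*_)
  import Data.Rational.Properties as ℚP
  open import Data.Fin using (_≟_)
  open import Data.List using (List; []; _∷_; _++_; foldl; filter; allFin)
  open import Data.List.Relation.Unary.All as All using (All; []; _∷_)
  open import Data.List.Relation.Unary.All.Properties using (all-filter)
  open import Data.List.Relation.Unary.AllPairs using (AllPairs; []; _∷_)
  open import Data.List.Relation.Unary.Unique.Propositional.Properties using (filter⁺; allFin⁺)
  open import Data.Maybe using (just; nothing)
  open import Data.Product using (_×_; _,_; proj₁; proj₂; Σ)
  open import Data.Sum using (inj₁; inj₂)
  open import Data.Empty using (⊥-elim)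
  open import Function using (_∘_)
  open import Relation.Nullary using (¬_; yes; no)
  open import Relation.Nullary.Decidable using (⌊_⌋)
  open import Relation.Binary.PropositionalEquality

  open Alg k n r p w pNZ

  -- The part of a state the analysis tracks: the recorded α⁺ values, the
  -- rejection flags and the history of T⁺ buckets.
  Ledger : Set
  Ledger = (Fin n → ℚ) × (Fin n → Bool) × List KeyP

  ledger : St n → Ledger
  ledger s = aP s , rej s , histP s

  updL-ledger : ∀ t s → ledger (updL t s) ≡ ledger s
  updL-ledger t s with cur s
  ... | nothing = refl
  ... | just j with not (inL s j) ∧ not (Σℚ[ (λ i → (start s ℕ.<ᵇ r i) ∧ (r i ℕ.≤ᵇ t)) ] w ℚ.≤ᵇ ofℕ k ℚ.* w j)
  ...   | true  = refl
  ...   | false = refl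

  step-ledger : ∀ {t s s'} → Step t s s' → ledger s' ≡ ledger (arrivals t s)
  step-ledger {t} {s} (continue _ _ refl) = updL-ledger t (arrivals t s)
  step-ledger {t} {s} (pick _ _ _ _ refl) = updL-ledger t (arrivals t s)
  step-ledger {t} {s} (idle _ _ refl)     = updL-ledger t (arrivals t s)

  if-same : ∀ {A : Set} (x : Fin n) (a b : A) → (if ⌊ x ≟ x ⌋ then a else b) ≡ a
  if-same x a b with x ≟ x
  ... | yes _   = refl
  ... | no x≢x  = ⊥-elim (x≢x refl)

  if-other : ∀ {A : Set} {y x : Fin n} (a b : A) → ¬ y ≡ x → (if ⌊ y ≟ x ⌋ then a else b) ≡ b
  if-other {y = y} {x} a b y≢x with y ≟ x
  ... | yes y≡x = ⊥-elim (y≢x y≡x)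
  ... | no _    = refl

  keyOf : ℚ → Fin n → KeyP
  keyOf a x = lg2 a (w x) , ⌊ w x ⌋₂

  -- The arrival of x records α⁺ and the rejection decision for x only; the
  -- decision is the T⁺ rule, possibly overridden by the T⁻ rule.
  arrive-other : ∀ t x s y → ¬ y ≡ x → aP (arrive t x s) y ≡ aP s y × rej (arrive t x s) y ≡ rej s y
  arrive-other t x s y y≢x = if-other _ (aP s y) y≢x , if-other _ (rej s y) y≢x

  arrive-α : ∀ t x s → aP (arrive t x s) x ≡ alphaP s t x
  arrive-α t x s = if-same x (alphaP s t x) (aP s x)

  arrive-rej : ∀ t x s → Σ Bool λ byT⁻ → rej (arrive t x s) x
             ≡ ((thr x ℚ.≤ᵇ alphaP s t x) ∧ ⌊ k ∣? count eqP (keyOf (alphaP s t x) x) (histP s) ⌋) ∨ byT⁻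
  arrive-rej t x s = _ , if-same x _ (rej s x)

  module Analysis (2≤k : 2 ℕ.≤ k) (0<w : ∀ j → 0ℚ < w j) (tr : ℕ → St n) (isRun : IsRun tr) where

    0≤alphaP : ∀ s t j → 0ℚ ≤ alphaP s t j
    0≤alphaP s t j =
      ℚP.+-mono-≤ (*-nonNeg (ℚP.<⇒≤ (0<w j)) (Σℚ[]-nonNeg (λ i → actArr s t j i ∧ inDp j i ∧ (ρ j ℚ.≤ᵇ ρ i)) _ (λ i → 0≤ofℕ (rem s i))))
                  (*-nonNeg (0≤ofℕ (p j)) (Σℚ[]-nonNeg (λ i → actArr s t j i ∧ inDp j i ∧ not (ρ j ℚ.≤ᵇ ρ i)) _
                                                  (λ i → *-nonNeg (0≤ρ i) (0≤ofℕ (rem s i)))))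
      where
      0≤ρ : ∀ i → 0ℚ ≤ ρ i
      0≤ρ i = *-nonNeg (ℚP.<⇒≤ (0<w i)) (ℚP.nonNegative⁻¹ _ {{ℚP.normalize-nonNeg 1 (p i) {{pNZ i}}}})

    0<thr : ∀ j → 0ℚ < thr j
    0<thr j = *-pos (*-pos (ofℕ-pos (ℕP.≤-trans (s≤s z≤n) 2≤k)) (0<w j))
                    (ofℕ-pos (ℕP.n≢0⇒n>0 (ℕ.≢-nonZero⁻¹ (p j) {{pNZ j}})))

    0≤thr : ∀ j → 0ℚ ≤ thr j
    0≤thr j = ℚP.<⇒≤ (0<thr j)

    α : Fin n → ℚ
    α = αplus tr

    inT⁺ : Fin n → Bool
    inT⁺ j = thr j ℚ.≤ᵇ α j

    0<α : ∀ {x} → inT⁺ x ≡ true → 0ℚ < α x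
    0<α {x} x∈T⁺ = ℚP.<-≤-trans (0<thr x) (ℚ≤ᵇ-true x∈T⁺)

    bucketValue : KeyP → ℚ
    bucketValue key = maxℚ n (λ j → keepIf (inT⁺ j ∧ eqP (keyOf (α j) j) key) (α j))

    0≤bucketValue : ∀ key → 0ℚ ≤ bucketValue key
    0≤bucketValue key = maxℚ-nonNeg n _

    α≤bucketValue : ∀ {x} → inT⁺ x ≡ true → α x ≤ bucketValue (keyOf (α x) x)
    α≤bucketValue {x} x∈T⁺ = subst (_≤ bucketValue (keyOf (α x) x)) own (maxℚ-upper n _ x)
      where
      own : keepIf (inT⁺ x ∧ eqP (keyOf (α x) x) (keyOf (α x) x)) (α x) ≡ α x
      own rewrite x∈T⁺ | eqP-refl (keyOf (α x) x) = refl

    bucketValue≤4α : ∀ {x} → inT⁺ x ≡ true → bucketValue (keyOf (α x) x) ≤ ofℕ 4 * α x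
    bucketValue≤4α {x} x∈T⁺ = maxℚ-least n _ (*-nonNeg (0≤ofℕ 4) (ℚP.<⇒≤ (0<α x∈T⁺))) member
      where
      member : ∀ j → keepIf (inT⁺ j ∧ eqP (keyOf (α j) j) (keyOf (α x) x)) (α j) ≤ ofℕ 4 * α x
      member j with inT⁺ j in j∈T⁺ | eqP (keyOf (α j) j) (keyOf (α x) x) in sameKey
      ... | true  | true  = sameBucket-≤4 (0<α x∈T⁺) (0<w x) (0<α j∈T⁺) (0<w j)
                              (sym (cong proj₁ keys)) (sym (cong proj₂ keys))
        where keys = eqP-sound {keyOf (α j) j} {keyOf (α x) x} sameKey
      ... | true  | false = *-nonNeg (0≤ofℕ 4) (ℚP.<⇒≤ (0<α x∈T⁺))
      ... | false | _     = *-nonNeg (0≤ofℕ 4) (ℚP.<⇒≤ (0<α x∈T⁺))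

    open HistoryWeight k bucketValue

    -- When x arrives with its final value α x, the potential it brings in is
    -- covered by the weight its T⁺ entry (if any) adds to the history h.
    entry-bound : ∀ x h byT⁻ {S} → 0ℚ ≤ α x → S ≤ weight h
      → S + potential k (thr x) (α x) ((inT⁺ x ∧ ⌊ k ∣? count eqP (keyOf (α x) x) h ⌋) ∨ byT⁻)
        ≤ weight (if inT⁺ x then h ++ keyOf (α x) x ∷ [] else h)
    entry-bound x h byT⁻ {S} 0≤αx S≤ with inT⁺ x in x∈T⁺ | ⌊ k ∣? count eqP (keyOf (α x) x) h ⌋ in rejected
    ... | true | true  = subst (S + potential k (thr x) (α x) true ≤_) (sym (weight-snoc h key))
        (ℚP.+-mono-≤ S≤ (subst (potential k (thr x) (α x) true ≤_) (cong (V *_) (sym (charge-rejected rejected)))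
                           (potential-rejected k 2≤k 0≤αx (0≤thr x) (bucketValue≤4α x∈T⁺))))
      where
      key = keyOf (α x) x
      V = bucketValue key
    ... | true | false = subst (S + potential k (thr x) (α x) byT⁻ ≤_) (sym (weight-snoc h key))
        (ℚP.+-mono-≤ S≤ (subst (potential k (thr x) (α x) byT⁻ ≤_)
                                (trans (sym (ℚP.*-identityʳ V)) (cong (V *_) (sym (charge-accepted rejected))))
                           (potential-accepted k byT⁻ 0≤αx (0≤thr x) (α≤bucketValue x∈T⁺))))
      where
      key = keyOf (α x) x
      V = bucketValue key
    ... | false | _ = subst (S + potential k (thr x) (α x) byT⁻ ≤_) (ℚP.+-identityʳ (weight h))
        (ℚP.+-mono-≤ S≤ (potential-below k byT⁻ 0≤αx (ℚP.<⇒≤ (ℚ≤ᵇ-false x∈T⁺))))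

    BoundedLedger : Ledger → Set
    BoundedLedger (αs , rejs , history) = sum (λ j → potential k (thr j) (αs j) (rejs j)) ≤ weight history

    Bounded : St n → Set
    Bounded s = BoundedLedger (ledger s)

    FreshLedger : Ledger → Fin n → Set
    FreshLedger (αs , rejs , _) y = αs y ≡ 0ℚ × rejs y ≡ false

    Fresh : St n → Fin n → Set
    Fresh s = FreshLedger (ledger s)

    arrival-step : ∀ t x s → alphaP s t x ≡ α x → Fresh s x → Bounded s → Bounded (arrive t x s)
    arrival-step t x s computed (α≡0 , rej≡false) bounded = begin
      sum (Ψ s')
        ≡⟨ sum-update (Ψ s) (Ψ s') x unchanged fresh-potential ⟩
      sum (Ψ s) + Ψ s' x
        ≡⟨ cong (sum (Ψ s) +_) recorded ⟩
      sum (Ψ s) + potential k (thr x) (α x) ((inT⁺ x ∧ ⌊ k ∣? count eqP (keyOf (α x) x) (histP s) ⌋) ∨ byT⁻)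
        ≤⟨ entry-bound x (histP s) byT⁻ (subst (0ℚ ≤_) computed (0≤alphaP s t x)) bounded ⟩
      weight (if inT⁺ x then histP s ++ keyOf (α x) x ∷ [] else histP s)
        ≡⟨ cong weight history ⟨
      weight (histP s')
        ∎
      where
      open ℚP.≤-Reasoning
      s' = arrive t x s
      Ψ : St n → Fin n → ℚ
      Ψ s j = potential k (thr j) (aP s j) (rej s j)
      byT⁻ = proj₁ (arrive-rej t x s)
      unchanged : ∀ i → ¬ i ≡ x → Ψ s' i ≡ Ψ s i
      unchanged i i≢x = cong₂ (potential k (thr i)) (proj₁ (arrive-other t x s i i≢x)) (proj₂ (arrive-other t x s i i≢x))
      fresh-potential : Ψ s x ≡ 0ℚ
      fresh-potential = trans (cong₂ (potential k (thr x)) α≡0 rej≡false) (potential-unarrived k (0≤thr x))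
      recorded : Ψ s' x ≡ potential k (thr x) (α x) ((inT⁺ x ∧ ⌊ k ∣? count eqP (keyOf (α x) x) (histP s) ⌋) ∨ byT⁻)
      recorded = cong₂ (potential k (thr x)) (trans (arrive-α t x s) computed)
        (trans (proj₂ (arrive-rej t x s))
               (cong (λ a → ((thr x ℚ.≤ᵇ a) ∧ ⌊ k ∣? count eqP (keyOf a x) (histP s) ⌋) ∨ byT⁻) computed))
      history : histP s' ≡ (if inT⁺ x then histP s ++ keyOf (α x) x ∷ [] else histP s)
      history = cong (λ a → if thr x ℚ.≤ᵇ a then histP s ++ keyOf a x ∷ [] else histP s) computed

    arriveAll : ℕ → St n → List (Fin n) → St n
    arriveAll t = foldl (λ s j → arrive t j s)

    arriveAll-other : ∀ t xs s y → All (λ x → ¬ y ≡ x) xs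
                    → aP (arriveAll t s xs) y ≡ aP s y × rej (arriveAll t s xs) y ≡ rej s y
    arriveAll-other t []       s y []            = refl , refl
    arriveAll-other t (x ∷ xs) s y (y≢x ∷ y∉xs) =
      trans (proj₁ rest) (proj₁ (arrive-other t x s y y≢x)) , trans (proj₂ rest) (proj₂ (arrive-other t x s y y≢x))
      where rest = arriveAll-other t xs (arrive t x s) y y∉xs

    arriveAll-bounded : ∀ t xs s → AllPairs (λ x y → ¬ x ≡ y) xs → All (Fresh s) xs
                      → All (λ y → aP (arriveAll t s xs) y ≡ α y) xs → Bounded s → Bounded (arriveAll t s xs)
    arriveAll-bounded t []       s _                 _                 _                 bounded = bounded
    arriveAll-bounded t (x ∷ xs) s (x∉xs ∷ distinct) (x-fresh ∷ fresh) (x-final ∷ final) bounded =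
      arriveAll-bounded t xs (arrive t x s) distinct
        (All.zipWith (λ { (y-fresh , x≢y) → still-fresh y-fresh x≢y }) (fresh , x∉xs)) final
        (arrival-step t x s computed x-fresh bounded)
      where
      computed : alphaP s t x ≡ α x
      computed = trans (sym (arrive-α t x s)) (trans (sym (proj₁ (arriveAll-other t xs (arrive t x s) x x∉xs))) x-final)
      still-fresh : ∀ {y} → Fresh s y → ¬ x ≡ y → Fresh (arrive t x s) y
      still-fresh {y} (α≡0 , rej≡false) x≢y =
        trans (proj₁ (arrive-other t x s y (x≢y ∘ sym))) α≡0 , trans (proj₂ (arrive-other t x s y (x≢y ∘ sym))) rej≡false

    arrivingAt : ℕ → List (Fin n)
    arrivingAt t = filter (λ j → r j ℕ.≟ t) (allFin n)

    arrivingAt-distinct : ∀ t → AllPairs (λ x y → ¬ x ≡ y) (arrivingAt t)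
    arrivingAt-distinct t = filter⁺ (λ j → r j ℕ.≟ t) (allFin⁺ n)

    arrivingAt-released : ∀ t → All (λ y → r y ≡ t) (arrivingAt t)
    arrivingAt-released t = all-filter (λ j → r j ℕ.≟ t) (allFin n)

    next-ledger : ∀ t → ledger (tr (suc t)) ≡ ledger (arriveAll t (tr t) (arrivingAt t))
    next-ledger t = step-ledger (proj₂ isRun t)

    untouched : ∀ t y → ¬ r y ≡ t → aP (tr (suc t)) y ≡ aP (tr t) y × rej (tr (suc t)) y ≡ rej (tr t) y
    untouched t y r≢t =
      trans (cong (λ L → proj₁ L y) (next-ledger t)) (proj₁ other) ,
      trans (cong (λ L → proj₁ (proj₂ L) y) (next-ledger t)) (proj₂ other)
      where
      other = arriveAll-other t (arrivingAt t) (tr t) y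
                (All.map (λ {x} r≡t y≡x → r≢t (trans (cong r y≡x) r≡t)) (arrivingAt-released t))

    invariant : ∀ t → Bounded (tr t) × (∀ y → t ℕ.≤ r y → Fresh (tr t) y)
    invariant zero rewrite proj₁ isRun =
      sum-nonPos _ (λ j → ℚP.≤-reflexive (potential-unarrived k (0≤thr j))) , λ _ _ → refl , refl
    invariant (suc t) =
      subst BoundedLedger (sym (next-ledger t))
        (arriveAll-bounded t (arrivingAt t) s (arrivingAt-distinct t)
          (All.map (λ r≡t → later (ℕP.≤-reflexive (sym r≡t))) (arrivingAt-released t))
          (All.map final (arrivingAt-released t)) bounded) ,
      λ y t<r → let (α≡ , rej≡) = untouched t y (ℕP.<⇒≢ t<r ∘ sym) ; (α≡0 , rej≡false) = later (ℕP.<⇒≤ t<r)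
                in trans α≡ α≡0 , trans rej≡ rej≡false
      where
      s = tr t
      bounded = proj₁ (invariant t)
      later = λ {y} → proj₂ (invariant t) y
      final : ∀ {y} → r y ≡ t → aP (arriveAll t s (arrivingAt t)) y ≡ α y
      final {y} r≡t rewrite r≡t = sym (cong (λ L → proj₁ L y) (next-ledger t))

    settled : ∀ y t → r y ℕ.< t → aP (tr t) y ≡ α y × rej (tr t) y ≡ immRej tr y
    settled y (suc t) r<1+t with ℕP.m≤n⇒m<n∨m≡n (ℕP.≤-pred r<1+t)
    ... | inj₂ refl = refl , refl
    ... | inj₁ r<t  = trans (proj₁ step) (proj₁ (settled y t r<t)) , trans (proj₂ step) (proj₂ (settled y t r<t))
      where step = untouched t y (ℕP.<⇒≢ r<t)

    -- a time after all releases
    horizon : ℕ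
    horizon = suc (natSum n r)

    potential-nonPos : sum (λ j → potential k (thr j) (α j) (immRej tr j)) ≤ 0ℚ
    potential-nonPos = subst (_≤ 0ℚ) (sum-cong-≗ final-values)
      (ℚP.≤-trans (proj₁ (invariant horizon)) (weight-nonPos 2≤k 0≤bucketValue (histP (tr horizon))))
      where
      final-values : ∀ j → potential k (thr j) (aP (tr horizon) j) (rej (tr horizon) j)
                         ≡ potential k (thr j) (α j) (immRej tr j)
      final-values j = let (α≡ , rej≡) = settled j horizon (s≤s (natSum-upper n r j))
                       in cong₂ (potential k (thr j)) α≡ rej≡

    αplus-bound : Σℚ n α ≤ ofℕ 4 * ofℕ k * (Σℚ n (λ j → w j * ofℕ (p j)) + Σℚ[ immRej tr ] α)
    αplus-bound rewrite Σℚ≡sum n α | Σℚ≡sum n (λ j → w j * ofℕ (p j)) | Σℚ≡sum n (λ j → keepIf (immRej tr j) (α j)) =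
      potential-sum-bound k n α thr (λ j → w j * ofℕ (p j)) (immRej tr)
        (λ j → ℚP.*-assoc (ofℕ k) (w j) (ofℕ (p j))) (λ j → *-nonNeg (ℚP.<⇒≤ (0<w j)) (0≤ofℕ (p j)))
        potential-nonPos

open import Data.Nat using (ℕ; _≤_; NonZero)
open import Data.Rational using (ℚ; 0ℚ; _<_; _+_; _*_) renaming (_≤_ to _≤ℚ_)
open import Data.Fin using (Fin)
open import Data.Product using (Σ; _,_)

lemma4p4 : Σ ℚ (λ C → (k : ℕ) → 2 ≤ k → (n : ℕ) → (r p : Fin n → ℕ) → (w : Fin n → ℚ)
             → (pNZ : (j : Fin n) → NonZero (p j)) → ((j : Fin n) → 0ℚ < w j)
             → (tr : ℕ → St n) → Alg.IsRun k n r p w pNZ tr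
             → Σℚ n (Alg.αplus k n r p w pNZ tr) ≤ℚ
                 (C * ofℕ k * (Σℚ n (λ j → w j * ofℕ (p j))
                   + Σℚ[ Alg.immRej k n r p w pNZ tr ] (Alg.αplus k n r p w pNZ tr))))
lemma4p4 = ofℕ 4 , λ k 2≤k n r p w pNZ 0<w tr isRun →
  RunAnalysis.Analysis.αplus-bound k n r p w pNZ 2≤k 0<w tr isRun
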